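{- Let $I$ be a non-empty set and $\langle n_i : i\in I\rangle\in{}^I\mathbb{N}$. For $m\in\mathbb{N}$ let $I_m=\{i\in I : n_i=m\}$ and let $K:=\{m\in\mathbb{N} : |I_m|\geq\omega\}$. Then $\langle n_i : i\in I\rangle$ is reversible if and only if $K$ is independent and, in case $K\neq\emptyset$, at most finitely many elements of the set $\{n_i : i\in I\}$ are divisible by $\gcd(K)$.
   Context: $\mathbb{N}=\{1,2,3,\dots\}$. A sequence $\langle n_i:i\in I\rangle$ of positive integers is reversible iff there is no non-injective surjection $f:I\to I$ such that $n_j=\sum_{i\in f^{ -1}[\{j\}]}n_i$ for all $j\in I$. For $K\subseteq\mathbb{N}$, $\langle K\rangle$ is the subsemigroup of $\langle\mathbb{N},+\rangle$ generated by $K$; $K$ is independent iff $n\notin\langle K\setminus\{n\}\rangle$ for every $n\in K$ (in particular $\emptyset$ is independent). -}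

module Defs where

open import Level using (0ℓ)
open import Data.Nat using (ℕ; _+_)
open import Data.Nat.Divisibility using (_∣_)
open import Data.List using (List; map)
open import Data.Nat.ListAction using (sum)
open import Data.List.Membership.Propositional using (_∈_)
open import Data.List.Relation.Unary.Unique.Propositional using (Unique)
open import Data.Product using (Σ; ∃; _×_)
open import Relation.Nullary using (¬_)
open import Relation.Binary.PropositionalEquality using (_≡_; _≢_)
open import Function.Definitions using (Injective)

-- Fibre-sum condition: the fibre f⁻¹[{j}] is finite (enumerated without
-- repetition by the list L) and n j = Σ_{i ∈ f⁻¹[{j}]} n i.
-- (A sum of positive integers over an infinite fibre is infinite, hence
-- never equals n j, so requiring finiteness loses nothing.)
FibreSum : {I : Set} → (I → ℕ) → (I → I) → I → Set
FibreSum {I} n f j =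
  Σ (List I) λ L →
    Unique L × (∀ i → f i ≡ j → i ∈ L) × (∀ i → i ∈ L → f i ≡ j)
    × sum (map n L) ≡ n j

Surj : {I : Set} → (I → I) → Set
Surj {I} f = ∀ (j : I) → ∃ λ i → f i ≡ j

Reversible : {I : Set} → (I → ℕ) → Set
Reversible {I} n =
  ¬ (Σ (I → I) λ f → Surj f × ¬ Injective _≡_ _≡_ f × (∀ j → FibreSum n f j))

-- K = { m : |I_m| ≥ ω }, I_m = { i : n i = m }: an injection ℕ → I_m exists.
KSet : {I : Set} → (I → ℕ) → ℕ → Set
KSet {I} n m = Σ (ℕ → I) λ g → Injective _≡_ _≡_ g × (∀ k → n (g k) ≡ m)

data Gen (P : ℕ → Set) : ℕ → Set where
  gen : ∀ {x} → P x → Gen P x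
  add : ∀ {x y} → Gen P x → Gen P y → Gen P (x + y)

Independent : (ℕ → Set) → Set
Independent P = ∀ k → P k → ¬ Gen (λ x → P x × x ≢ k) k

IsGcdOf : (ℕ → Set) → ℕ → Set
IsGcdOf P d = (∀ k → P k → d ∣ k) × (∀ e → (∀ k → P k → e ∣ k) → e ∣ d)

FiniteSetℕ : (ℕ → Set) → Set
FiniteSetℕ P = Σ (List ℕ) λ L → ∀ v → P v → v ∈ L

-- Call f a merger of n if it is a non-injective surjection with n j = Σ_{f i = j} n i; then n never
-- decreases along f. A point off the cycles of f has its value in ⟨K⟩: walk backwards through
-- preimages; if n never drops, the walk consists of infinitely many indices of one value, and at the
-- first drop the value splits into smaller values of points off the cycles. If f identifies i ≠ i',
-- every value on the forward orbit of f i lies in ⟨K⟩ + ⟨K⟩, so is a multiple of gcd K; if there are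
-- only finitely many such values, n is eventually constant on the orbit, which makes that value an
-- element of K inside ⟨K⟩ + ⟨K⟩, against independence.
-- Conversely, a merger is built from a spine of indices z₀, z₁, … with n z₀ = Σ B₀ and
-- n zₜ₊₁ = n zₜ + Σ Bₜ₊₁ for finite lists Bₜ of elements of K, each entry of Bₜ fed by an infinite
-- ray of indices of that value. A relation k ∈ ⟨K ∖ {k}⟩ gives such a spine of copies of k; infinitely
-- many values divisible by gcd K give one inside a residue class modulo some k ∈ K.
module Submission where

open import Defs
open import Level using (0ℓ)
open import Axiom.ExcludedMiddle using (ExcludedMiddle)
open import Data.Nat using (ℕ; zero; suc; pred; _+_; _*_; _∸_; _<_; _≤_; z≤n; s≤s; NonZero; >-nonZero)
open import Data.Nat.Properties
open import Data.Nat.Divisibility using (_∣_; divides; ∣m∣n⇒∣m+n; ∣m+n∣m⇒∣n; ∣-trans; n∣m*n; m%n≡0⇒n∣m)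
open import Data.Nat.DivMod using (_%_; _/_; m≡m%n+[m/n]*n; m%n<n; [m+kn]%n≡m%n; /-monoˡ-≤)
open import Data.Nat.Induction using (<-rec)
open import Data.Nat.GeneralisedArithmetic using (fold; fold-+)
open import Data.Nat.ListAction using (sum)
open import Data.Nat.ListAction.Properties using (sum-++)
open import Data.Nat.Solver using (module +-*-Solver)
open import Data.List using (List; []; _∷_; map; length; tabulate; lookup; _++_; replicate; upTo)
open import Data.List.Properties using (map-tabulate; tabulate-lookup; tabulate-cong; map-∘; length-++; length-replicate)
open import Data.List.Membership.Propositional using (_∈_)
open import Data.List.Membership.Propositional.Properties using (∈-tabulate⁺; ∈-tabulate⁻; ∈-map⁺; ∈-map⁻; ∈-++⁺ˡ; ∈-++⁺ʳ; ∈-upTo⁺; ∈-lookup)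
open import Data.List.Relation.Unary.Any using (here; there)
open import Data.List.Relation.Unary.All as All using (All; []; _∷_)
import Data.List.Relation.Unary.All.Properties as All
open import Data.List.Relation.Unary.AllPairs using ([]; _∷_)
open import Data.List.Relation.Unary.Unique.Propositional using (Unique)
import Data.List.Relation.Unary.Unique.Propositional.Properties as Unique
open import Data.Fin using (Fin; toℕ; fromℕ<)
import Data.Fin.Properties as Fin
open import Data.Product using (Σ; ∃; _×_; _,_; proj₁; proj₂)
open import Data.Sum using (_⊎_; inj₁; inj₂)
open import Data.Empty using (⊥; ⊥-elim)
open import Function using (_∘_)
open import Function.Bundles using (_⇔_; mk⇔)
open import Function.Definitions using (Injective)
open import Relation.Binary.Definitions using (tri<; tri≈; tri>)
open import Relation.Binary.PropositionalEquality using (_≡_; _≢_; refl; sym; trans; cong; cong₂; subst; module ≡-Reasoning)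
open import Algebra.Properties.CommutativeSemigroup +-commutativeSemigroup using (x∙yz≈y∙xz)
open import Relation.Nullary using (¬_; Dec; yes; no)

<⇒≡suc+ : ∀ {k k'} → k < k' → ∃ λ q → k' ≡ suc q + k
<⇒≡suc+ {k} k<k' with m≤n⇒∃[o]m+o≡n k<k'
... | q , refl = q , cong suc (+-comm k q)

module _ {A : Set} (g : ℕ → A) (no-return : ∀ q k → g (suc q + k) ≢ g k) where

  private
    no-return-< : ∀ {k k'} → k < k' → g k ≢ g k'
    no-return-< k<k' e with <⇒≡suc+ k<k'
    ... | q , refl = no-return q _ (sym e)

  no-return⇒injective : Injective _≡_ _≡_ g
  no-return⇒injective {k} {k'} e with <-cmp k k'
  ... | tri< k<k' _ _ = ⊥-elim (no-return-< k<k' e)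
  ... | tri≈ _ k≡k' _ = k≡k'
  ... | tri> _ _ k>k' = ⊥-elim (no-return-< k>k' (sym e))

increasing⇒injective : (v : ℕ → ℕ) → (∀ t → v t < v (suc t)) → Injective _≡_ _≡_ v
increasing⇒injective v incr = no-return⇒injective v λ q k → >⇒≢ (increasing q k)
  where
  increasing : ∀ q k → v k < v (suc q + k)
  increasing zero k = incr k
  increasing (suc q) k = <-trans (increasing q k) (incr (suc q + k))

∈⇒≤sum : ∀ {x : ℕ} {xs} → x ∈ xs → x ≤ sum xs
∈⇒≤sum {xs = y ∷ ys} (here refl) = m≤m+n y (sum ys)
∈⇒≤sum {xs = y ∷ ys} (there x∈ys) = ≤-trans (∈⇒≤sum x∈ys) (m≤n+m (sum ys) y)

sum-replicate : ∀ m k → sum (replicate m k) ≡ m * k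
sum-replicate zero k = refl
sum-replicate (suc m) k = cong (k +_) (sum-replicate m k)

≡-mod⇒+* : ∀ {x y k} .{{_ : NonZero k}} → x % k ≡ y % k → y ≤ x → ∃ λ q → x ≡ y + q * k
≡-mod⇒+* {x} {y} {k} x≡y-mod y≤x with m≤n⇒∃[o]m+o≡n (/-monoˡ-≤ k y≤x)
... | q , y/k+q≡x/k = q , (begin
  x                             ≡⟨ m≡m%n+[m/n]*n x k ⟩
  x % k + x / k * k             ≡⟨ cong₂ (λ r a → r + a * k) x≡y-mod (sym y/k+q≡x/k) ⟩
  y % k + (y / k + q) * k       ≡⟨ cong (y % k +_) (*-distribʳ-+ k (y / k) q) ⟩
  y % k + (y / k * k + q * k)   ≡⟨ +-assoc (y % k) _ _ ⟨
  y % k + y / k * k + q * k     ≡⟨ cong (_+ q * k) (m≡m%n+[m/n]*n y k) ⟨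
  y + q * k                     ∎)
  where open ≡-Reasoning

triangle : ℕ → ℕ
triangle zero = 0
triangle (suc s) = triangle s + suc s

triangle-mono : ∀ {s s'} → s ≤ s' → triangle s ≤ triangle s'
triangle-mono {s' = zero} z≤n = ≤-refl
triangle-mono {s' = suc s'} s≤1+s' with m≤n⇒m<n∨m≡n s≤1+s'
... | inj₁ (s≤s s≤s') = ≤-trans (triangle-mono s≤s') (m≤m+n _ _)
... | inj₂ refl = ≤-refl

-- Cantor's pairing function: pair a b lies in [triangle (a + b), triangle (a + b + 1)).
pair : ℕ → ℕ → ℕ
pair a b = triangle (a + b) + a

pair-mono-< : ∀ a b a' b' → a + b < a' + b' → pair a b < pair a' b'
pair-mono-< a b a' b' lt =
  <-≤-trans (+-monoʳ-< (triangle (a + b)) (s≤s (m≤m+n a b))) (≤-trans (triangle-mono lt) (m≤m+n _ a'))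

pair-injective : ∀ {a b a' b'} → pair a b ≡ pair a' b' → a ≡ a' × b ≡ b'
pair-injective {a} {b} {a'} {b'} e with <-cmp (a + b) (a' + b')
... | tri< lt _ _ = ⊥-elim (<⇒≢ (pair-mono-< a b a' b' lt) e)
... | tri> _ _ gt = ⊥-elim (<⇒≢ (pair-mono-< a' b' a b gt) (sym e))
... | tri≈ _ s≡s' _ = a≡a' , +-cancelˡ-≡ a b b' (trans s≡s' (cong (_+ b') (sym a≡a')))
  where
  a≡a' : a ≡ a'
  a≡a' = +-cancelˡ-≡ (triangle (a + b)) a a' (trans e (cong (λ x → triangle x + a') (sym s≡s')))

Gen-map : {P Q : ℕ → Set} → (∀ {x} → P x → Q x) → ∀ {y} → Gen P y → Gen Q y
Gen-map P⇒Q (gen p) = gen (P⇒Q p)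
Gen-map P⇒Q (add g h) = add (Gen-map P⇒Q g) (Gen-map P⇒Q h)

module _ {P : ℕ → Set} where

  Gen-bounded : ∀ {y} → Gen P y → Gen (λ x → P x × x ≤ y) y
  Gen-bounded (gen p) = gen (p , ≤-refl)
  Gen-bounded (add {x} {y} g h) =
    add (Gen-map (λ (p , le) → p , ≤-trans le (m≤m+n x y)) (Gen-bounded g))
        (Gen-map (λ (p , le) → p , ≤-trans le (m≤n+m y x)) (Gen-bounded h))

  Gen-avoiding : ∀ {v y} → y < v → Gen P y → Gen (λ x → P x × x ≢ v) y
  Gen-avoiding y<v g = Gen-map (λ (p , x≤y) → p , <⇒≢ (≤-<-trans x≤y y<v)) (Gen-bounded g)

  Gen-divisible : ∀ {d} → (∀ {x} → P x → d ∣ x) → ∀ {y} → Gen P y → d ∣ y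
  Gen-divisible d∣P (gen p) = d∣P p
  Gen-divisible d∣P (add g h) = ∣m∣n⇒∣m+n (Gen-divisible d∣P g) (Gen-divisible d∣P h)

  Gen-positive : (∀ {x} → P x → 0 < x) → ∀ {y} → Gen P y → 0 < y
  Gen-positive P-pos (gen p) = P-pos p
  Gen-positive P-pos (add g h) = ≤-trans (Gen-positive P-pos g) (m≤m+n _ _)

  Gen-witness : ∀ {y} → Gen P y → ∃ P
  Gen-witness (gen p) = _ , p
  Gen-witness (add g _) = Gen-witness g

  Gen⇒sum : ∀ {y} → Gen P y → Σ (List ℕ) λ xs → All P xs × sum xs ≡ y × 1 ≤ length xs
  Gen⇒sum (gen {x} p) = x ∷ [] , p ∷ [] , +-identityʳ x , ≤-refl
  Gen⇒sum (add g h) with Gen⇒sum g | Gen⇒sum h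
  ... | xs , Pxs , refl , 1≤∣xs∣ | ys , Pys , refl , _ =
    xs ++ ys , All.++⁺ Pxs Pys , sum-++ xs ys ,
    ≤-trans 1≤∣xs∣ (≤-trans (m≤m+n _ _) (≤-reflexive (sym (length-++ xs))))

  Gen⇒proper-sum : ∀ {y} → ¬ P y → Gen P y → Σ (List ℕ) λ xs → All P xs × sum xs ≡ y × 2 ≤ length xs
  Gen⇒proper-sum ¬Py (gen p) = ⊥-elim (¬Py p)
  Gen⇒proper-sum _ (add g h) with Gen⇒sum g | Gen⇒sum h
  ... | xs , Pxs , refl , 1≤∣xs∣ | ys , Pys , refl , 1≤∣ys∣ =
    xs ++ ys , All.++⁺ Pxs Pys , sum-++ xs ys ,
    ≤-trans (+-mono-≤ 1≤∣xs∣ 1≤∣ys∣) (≤-reflexive (sym (length-++ xs)))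

  Gen₀ : ℕ → Set
  Gen₀ y = y ≡ 0 ⊎ Gen P y

  Gen₀-+ : ∀ {x y} → Gen₀ x → Gen₀ y → Gen₀ (x + y)
  Gen₀-+ (inj₁ refl) gy = gy
  Gen₀-+ {x} (inj₂ gx) (inj₁ refl) = inj₂ (subst (Gen P) (sym (+-identityʳ x)) gx)
  Gen₀-+ (inj₂ gx) (inj₂ gy) = inj₂ (add gx gy)

  Gen₀-sum : {A : Set} (w : A → ℕ) (xs : List A) → (∀ {x} → x ∈ xs → Gen P (w x)) → Gen₀ (sum (map w xs))
  Gen₀-sum w [] _ = inj₁ refl
  Gen₀-sum w (x ∷ xs) gen-w = Gen₀-+ (inj₂ (gen-w (here refl))) (Gen₀-sum w xs (gen-w ∘ there))

  Gen₀-positive : ∀ {y} → 0 < y → Gen₀ y → Gen P y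
  Gen₀-positive 0<y (inj₁ refl) = ⊥-elim (<-irrefl refl 0<y)
  Gen₀-positive _ (inj₂ g) = g

  Gen₂ : ℕ → Set
  Gen₂ v = ∃ λ a → ∃ λ b → Gen P a × Gen P b × v ≡ a + b

  Gen₂-+ : ∀ {v r} → Gen₂ v → Gen₀ r → Gen₂ (v + r)
  Gen₂-+ {v} (a , b , ga , gb , refl) (inj₁ refl) = a , b , ga , gb , +-identityʳ (a + b)
  Gen₂-+ {r = r} (a , b , ga , gb , refl) (inj₂ gr) = a , b + r , ga , add gb gr , +-assoc a b r

  Gen₂-divisible : ∀ {d} → (∀ {x} → P x → d ∣ x) → ∀ {v} → Gen₂ v → d ∣ v
  Gen₂-divisible d∣P (a , b , ga , gb , refl) = ∣m∣n⇒∣m+n (Gen-divisible d∣P ga) (Gen-divisible d∣P gb)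

  Independent⇒∉Gen₂ : Independent P → (∀ {x} → P x → 0 < x) → ∀ {v} → Gen₂ v → ¬ P v
  Independent⇒∉Gen₂ indep P-pos (a , b , ga , gb , refl) Pa+b =
    indep (a + b) Pa+b (add (Gen-avoiding (m<m+n a (Gen-positive P-pos gb)) ga)
                            (Gen-avoiding (m<n+m b (Gen-positive P-pos ga)) gb))

module _ {A : Set} (w : A → ℕ) where

  sum-remove : ∀ {x xs} → x ∈ xs → Σ (List A) λ rest → sum (map w xs) ≡ w x + sum (map w rest)
               × (∀ {y} → y ∈ rest → y ∈ xs) × (∀ {y} → y ∈ xs → y ≢ x → y ∈ rest)
  sum-remove {xs = _ ∷ xs} (here refl) =
    xs , refl , there , λ { (here refl) y≢x → ⊥-elim (y≢x refl) ; (there y∈) _ → y∈ }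
  sum-remove {x} {xs = a ∷ xs} (there x∈xs) with sum-remove x∈xs
  ... | rest , sum-xs , rest⊆xs , others∈rest = a ∷ rest , sum-a∷xs , ∷-mono rest⊆xs , others∈a∷rest
    where
    sum-a∷xs : w a + sum (map w xs) ≡ w x + (w a + sum (map w rest))
    sum-a∷xs = trans (cong (w a +_) sum-xs) (x∙yz≈y∙xz (w a) (w x) _)
    ∷-mono : (∀ {y} → y ∈ rest → y ∈ xs) → ∀ {y} → y ∈ a ∷ rest → y ∈ a ∷ xs
    ∷-mono _ (here refl) = here refl
    ∷-mono sub (there y∈) = there (sub y∈)
    others∈a∷rest : ∀ {y} → y ∈ a ∷ xs → y ≢ x → y ∈ a ∷ rest
    others∈a∷rest (here refl) _ = here refl
    others∈a∷rest (there y∈) y≢x = there (others∈rest y∈ y≢x)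

finite-fibres⇒finite : {P : ℕ → Set} (r : ℕ → ℕ) (N : ℕ) → (∀ {v} → P v → r v < N) →
                       (∀ c → FiniteSetℕ (λ v → P v × r v ≡ c)) → FiniteSetℕ P
finite-fibres⇒finite {P} r N r<N finite-fibre = proj₁ (cover N) , λ v Pv → proj₂ (cover N) Pv (r<N Pv)
  where
  cover : ∀ M → Σ (List ℕ) λ L → ∀ {v} → P v → r v < M → v ∈ L
  cover zero = [] , λ _ ()
  cover (suc M) with cover M | finite-fibre M
  ... | L , L-covers | L' , L'-covers = L ++ L' , covers
    where
    covers : ∀ {v} → P v → r v < suc M → v ∈ L ++ L'
    covers {v} Pv (s≤s rv≤M) with m≤n⇒m<n∨m≡n rv≤M
    ... | inj₁ rv<M = ∈-++⁺ˡ (L-covers Pv rv<M)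
    ... | inj₂ rv≡M = ∈-++⁺ʳ L (L'-covers v (Pv , rv≡M))

module Classical (em : ExcludedMiddle 0ℓ) where

  least-witness : {Q : ℕ → Set} {x : ℕ} → Q x → ∃ λ y → Q y × (∀ {k} → k < y → ¬ Q k)
  least-witness {Q} {x} Qx with em {∃ λ y → Q y × (∀ {k} → k < y → ¬ Q k)}
  ... | yes least = least
  ... | no ¬least = ⊥-elim (<-rec (λ m → ¬ Q m) (λ m below Qm → ¬least (m , Qm , below)) x Qx)

  collision : {A B : Set} {f : A → B} → ¬ Injective _≡_ _≡_ f → ∃ λ x → ∃ λ y → f x ≡ f y × x ≢ y
  collision {f = f} ¬inj with em {∃ λ x → ∃ λ y → f x ≡ f y × x ≢ y}
  ... | yes c = c
  ... | no ¬c = ⊥-elim (¬inj λ {x} {y} e → case-≡ x y e)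
    where
    case-≡ : ∀ x y → f x ≡ f y → x ≡ y
    case-≡ x y e with em {x ≡ y}
    ... | yes x≡y = x≡y
    ... | no x≢y = ⊥-elim (¬c (x , y , e , x≢y))

  -- Take t₀ minimising bound ∸ a t₀.
  monotone-bounded⇒stable : (a : ℕ → ℕ) → (∀ t → a t ≤ a (suc t)) → ∀ bound → (∀ t → a t ≤ bound) →
                            ∃ λ t₀ → ∀ s → a (s + t₀) ≡ a t₀
  monotone-bounded⇒stable a mono bound a≤bound with least-witness {λ m → ∃ λ t → bound ∸ a t ≡ m} (0 , refl)
  ... | _ , (t₀ , refl) , minimal = t₀ , λ s →
    ≤-antisym (≮⇒≥ (λ lt → minimal (∸-monoʳ-< lt (a≤bound (s + t₀))) (s + t₀ , refl))) (mono-+ s)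
    where
    mono-+ : ∀ s → a t₀ ≤ a (s + t₀)
    mono-+ zero = ≤-refl
    mono-+ (suc s) = ≤-trans (mono-+ s) (mono (s + t₀))

  module _ {P : ℕ → Set} (infinite : ¬ FiniteSetℕ P) where

    infinite⇒unbounded : ∀ b → ∃ λ v → P v × b < v
    infinite⇒unbounded b with em {∃ λ v → P v × b < v}
    ... | yes above = above
    ... | no ¬above =
      ⊥-elim (infinite (upTo (suc b) , λ v Pv → ∈-upTo⁺ (s≤s (≮⇒≥ λ b<v → ¬above (v , Pv , b<v)))))

    increasing-sequence-above : ∀ b → Σ (ℕ → ℕ) λ v →
                                (∀ t → P (v t) × b < v t) × (∀ t → v t < v (suc t))
    increasing-sequence-above b = v , v-in-P , v-increasing
      where
      next : ∀ b → ∃ λ v → P v × b < v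
      next = infinite⇒unbounded
      v : ℕ → ℕ
      v zero = proj₁ (next b)
      v (suc t) = proj₁ (next (v t))
      v-increasing : ∀ t → v t < v (suc t)
      v-increasing t = proj₂ (proj₂ (next (v t)))
      v-in-P : ∀ t → P (v t) × b < v t
      v-in-P zero = proj₂ (next b)
      v-in-P (suc t) = proj₁ (proj₂ (next (v t))) , <-trans (proj₂ (v-in-P t)) (v-increasing t)

    infinite-fibre : (r : ℕ → ℕ) (N : ℕ) → (∀ {v} → P v → r v < N) →
                     ∃ λ c → ¬ FiniteSetℕ (λ v → P v × r v ≡ c)
    infinite-fibre r N r<N with em {∃ λ c → ¬ FiniteSetℕ (λ v → P v × r v ≡ c)}
    ... | yes c = c
    ... | no ¬c = ⊥-elim (infinite (finite-fibres⇒finite r N r<N finite-fibre))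
      where
      finite-fibre : ∀ c → FiniteSetℕ (λ v → P v × r v ≡ c)
      finite-fibre c with em {FiniteSetℕ (λ v → P v × r v ≡ c)}
      ... | yes finite = finite
      ... | no ¬finite = ⊥-elim (¬c (c , ¬finite))

open +-*-Solver using (solve; _:+_; _:*_; _:=_; con)

module GcdOf (em : ExcludedMiddle 0ℓ) {P : ℕ → Set} (P-pos : ∀ {x} → P x → 0 < x) {k : ℕ} (Pk : P k) where

  -- Adding multiples of k ∈ P turns ⟨P⟩ ∪ {0} into a stand-in, within ℕ, for the subgroup of ℤ
  -- generated by P.
  Reaches : ℕ → Set
  Reaches x = ∃ λ a → Gen₀ {P} (x + a * k)

  Reaches-+ : ∀ {x y} → Reaches x → Reaches y → Reaches (x + y)
  Reaches-+ {x} {y} (a , g) (b , h) = a + b , subst Gen₀ (regroup x a k y b) (Gen₀-+ g h)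
    where
    regroup : ∀ x a k y b → (x + a * k) + (y + b * k) ≡ (x + y) + (a + b) * k
    regroup = solve 5 (λ x a k y b → (x :+ a :* k) :+ (y :+ b :* k) := (x :+ y) :+ (a :+ b) :* k) refl

  Reaches-* : ∀ c {x} → Reaches x → Reaches (c * x)
  Reaches-* zero _ = 0 , inj₁ refl
  Reaches-* (suc c) rx = Reaches-+ rx (Reaches-* c rx)

  Reaches-P : ∀ {x} → P x → Reaches x
  Reaches-P {x} Px = 0 , inj₂ (subst (Gen P) (sym (+-identityʳ x)) (gen Px))

  Reaches-+* : ∀ r c → Reaches (r + c * k) → Reaches r
  Reaches-+* r c (a , g) = c + a , subst Gen₀ (regroup r c a k) g
    where
    regroup : ∀ r c a k → r + c * k + a * k ≡ r + (c + a) * k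
    regroup = solve 4 (λ r c a k → r :+ c :* k :+ a :* k := r :+ (c :+ a) :* k) refl

  -- To subtract x, add (k - 1) x and discard the multiple x k of k.
  Reaches-cancelʳ : ∀ r x → Reaches (r + x) → Reaches x → Reaches r
  Reaches-cancelʳ r x rr+x rx with P-pos Pk
  ... | s≤s _ = Reaches-+* r x (subst Reaches (regroup r x (pred k)) (Reaches-+ rr+x (Reaches-* (pred k) rx)))
    where
    regroup : ∀ r x k' → r + x + k' * x ≡ r + x * suc k'
    regroup = solve 3 (λ r x k' → r :+ x :+ k' :* x := r :+ x :* (con 1 :+ k')) refl

  private
    least-positive : ∃ λ g → (0 < g × Reaches g) × (∀ {m} → m < g → ¬ (0 < m × Reaches m))
    least-positive = Classical.least-witness em (P-pos Pk , Reaches-P Pk)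

  gcd : ℕ
  gcd = proj₁ least-positive

  gcd-positive : 0 < gcd
  gcd-positive = proj₁ (proj₁ (proj₂ least-positive))

  Reaches-gcd : Reaches gcd
  Reaches-gcd = proj₂ (proj₁ (proj₂ least-positive))

  instance
    gcd-nonZero : NonZero gcd
    gcd-nonZero = >-nonZero gcd-positive

  gcd∣P : ∀ {x} → P x → gcd ∣ x
  gcd∣P {x} Px = m%n≡0⇒n∣m x gcd (remainder≡0 (x % gcd) (m%n<n x gcd) Reaches-remainder)
    where
    Reaches-remainder : Reaches (x % gcd)
    Reaches-remainder = Reaches-cancelʳ (x % gcd) (x / gcd * gcd)
      (subst Reaches (m≡m%n+[m/n]*n x gcd) (Reaches-P Px)) (Reaches-* (x / gcd) Reaches-gcd)
    remainder≡0 : ∀ r → r < gcd → Reaches r → r ≡ 0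
    remainder≡0 zero _ _ = refl
    remainder≡0 (suc r) r<gcd rr = ⊥-elim (proj₂ (proj₂ least-positive) r<gcd (s≤s z≤n , rr))

  gcd-IsGcdOf : IsGcdOf P gcd
  gcd-IsGcdOf = (λ _ → gcd∣P) , common-divisor∣gcd
    where
    common-divisor∣gcd : ∀ e → (∀ x → P x → e ∣ x) → e ∣ gcd
    common-divisor∣gcd e e∣P with Reaches-gcd
    ... | a , inj₁ gcd+ak≡0 = ⊥-elim (<⇒≢ (≤-trans gcd-positive (m≤m+n gcd (a * k))) (sym gcd+ak≡0))
    ... | a , inj₂ g = ∣m+n∣m⇒∣n (subst (e ∣_) (+-comm gcd (a * k)) (Gen-divisible (e∣P _) g))
                                  (∣-trans (e∣P k Pk) (n∣m*n a))

  multiple-of-gcd⇒Reaches : ∀ {v} → gcd ∣ v → Reaches v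
  multiple-of-gcd⇒Reaches (divides q refl) = Reaches-* q Reaches-gcd

Value : {I : Set} → (I → ℕ) → ℕ → Set
Value n v = ∃ λ i → n i ≡ v

GcdFiniteness : {I : Set} → (I → ℕ) → Set
GcdFiniteness n = (∃ λ m → KSet n m) → ∀ d → IsGcdOf (KSet n) d → FiniteSetℕ (λ v → Value n v × d ∣ v)

Merger : {I : Set} → (I → ℕ) → Set
Merger {I} n = Σ (I → I) λ f → Surj f × ¬ Injective _≡_ _≡_ f × (∀ j → FibreSum n f j)

-- A merger of the subfamily n ∘ s extends to a merger of n by the identity off the image of s.
module Extension (em : ExcludedMiddle 0ℓ) {I T : Set} (n : I → ℕ) (s : T → I) (s-inj : Injective _≡_ _≡_ s)
                 (φ : T → T) (φ-surj : Surj φ) (φ-ninj : ¬ Injective _≡_ _≡_ φ)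
                 (φ-fibre : ∀ u → FibreSum (n ∘ s) φ u) where

  InImage : I → Set
  InImage i = ∃ λ u → s u ≡ i

  extend : (i : I) → Dec (InImage i) → I
  extend i (yes (u , _)) = s (φ u)
  extend i (no _) = i

  f : I → I
  f i = extend i em

  extend-s : ∀ u (d : Dec (InImage (s u))) → extend (s u) d ≡ s (φ u)
  extend-s u (yes (u' , su'≡su)) = cong (s ∘ φ) (s-inj su'≡su)
  extend-s u (no ∉image) = ⊥-elim (∉image (u , refl))

  f-s : ∀ u → f (s u) ≡ s (φ u)
  f-s u = extend-s u em

  f-cases : ∀ i → (∃ λ u → s u ≡ i × f i ≡ s (φ u)) ⊎ (¬ InImage i × f i ≡ i)
  f-cases i with em {InImage i}
  ... | yes (u , refl) = inj₁ (u , refl , extend-s u (yes (u , refl)))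
  ... | no ∉image = inj₂ (∉image , refl)

  f-outside : ∀ i → ¬ InImage i → f i ≡ i
  f-outside i ∉image with f-cases i
  ... | inj₁ (u , su≡i , _) = ⊥-elim (∉image (u , su≡i))
  ... | inj₂ (_ , fi≡i) = fi≡i

  f-surj : Surj f
  f-surj j with em {InImage j}
  ... | yes (u , refl) = let u' , φu'≡u = φ-surj u in s u' , trans (f-s u') (cong s φu'≡u)
  ... | no ∉image = j , f-outside j ∉image

  f-ninj : ¬ Injective _≡_ _≡_ f
  f-ninj f-inj = φ-ninj λ {x} {y} e → s-inj (f-inj (trans (f-s x) (trans (cong s e) (sym (f-s y)))))

  fibre-inside : ∀ u → FibreSum n f (s u)
  fibre-inside u with φ-fibre u
  ... | L , unique , complete , sound , total = map s L , Unique.map⁺ s-inj unique , complete' , sound' , total'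
    where
    complete' : ∀ i → f i ≡ s u → i ∈ map s L
    complete' i fi≡su with f-cases i
    ... | inj₁ (u' , refl , fi≡) = ∈-map⁺ s (complete u' (s-inj (trans (sym fi≡) fi≡su)))
    ... | inj₂ (∉image , fi≡i) = ⊥-elim (∉image (u , trans (sym fi≡su) fi≡i))
    sound' : ∀ i → i ∈ map s L → f i ≡ s u
    sound' i i∈sL with ∈-map⁻ s i∈sL
    ... | u' , u'∈L , refl = trans (f-s u') (cong s (sound u' u'∈L))
    total' : sum (map n (map s L)) ≡ n (s u)
    total' = trans (cong sum (sym (map-∘ L))) total

  fibre-outside : ∀ j → ¬ InImage j → FibreSum n f j
  fibre-outside j ∉image = j ∷ [] , [] ∷ [] , complete , sound , +-identityʳ (n j)
    where
    complete : ∀ i → f i ≡ j → i ∈ j ∷ []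
    complete i fi≡j with f-cases i
    ... | inj₁ (u , refl , fi≡) = ⊥-elim (∉image (φ u , trans (sym fi≡) fi≡j))
    ... | inj₂ (_ , fi≡i) = here (trans (sym fi≡i) fi≡j)
    sound : ∀ i → i ∈ j ∷ [] → f i ≡ j
    sound i (here refl) = f-outside j ∉image

  fibre : ∀ j → FibreSum n f j
  fibre j with em {InImage j}
  ... | yes (u , refl) = fibre-inside u
  ... | no ∉image = fibre-outside j ∉image

  merger : Merger n
  merger = f , f-surj , f-ninj , fibre

Merger-extend : ExcludedMiddle 0ℓ → {I T : Set} (n : I → ℕ) (s : T → I) →
                Injective _≡_ _≡_ s → Merger (n ∘ s) → Merger n
Merger-extend em n s s-inj (φ , φ-surj , φ-ninj , φ-fibre) =
  Extension.merger em n s s-inj φ φ-surj φ-ninj φ-fibre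

Copies : {I : Set} → (I → ℕ) → (ℕ → I) → ℕ → Set
Copies n g a = Injective _≡_ _≡_ g × (∀ k → n (g k) ≡ a)

module Chain {I : Set} (n : I → ℕ) (pos : ∀ i → 0 < n i)
             (z : ℕ → I) (z-inj : Injective _≡_ _≡_ z)
             (block : ℕ → List ℕ) (copies : ℕ → ℕ → I)
             (block-ok : ∀ t → All (λ a → Copies n (copies a) a × (∀ t' → n (z t') ≢ a)) (block t))
             (z-zero : n (z 0) ≡ sum (block 0))
             (z-suc : ∀ t → n (z (suc t)) ≡ n (z t) + sum (block (suc t)))
             (branching : 2 ≤ length (block 0) ⊎ ∃ λ t → 1 ≤ length (block (suc t))) where

  Position : Set
  Position = ∃ λ t → Fin (length (block t))

  value : Position → ℕ
  value (t , j) = lookup (block t) j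

  position-ok : ∀ p → Copies n (copies (value p)) (value p) × (∀ t' → n (z t') ≢ value p)
  position-ok (t , j) = All.lookup (block-ok t) (∈-lookup j)

  code : Position → ℕ → ℕ
  code (t , j) u = pair t (pair (toℕ j) u)

  code-injective : ∀ {p u p' u'} → code p u ≡ code p' u' → p ≡ p' × u ≡ u'
  code-injective {t , j} {u} {t' , j'} {u'} e with pair-injective {t} {pair (toℕ j) u} {t'} {pair (toℕ j') u'} e
  ... | refl , e' with pair-injective {toℕ j} {u} {toℕ j'} {u'} e'
  ... | j≡j' , refl with Fin.toℕ-injective j≡j'
  ... | refl = refl , refl

  T : Set
  T = (Position × ℕ) ⊎ ℕ

  s : T → I
  s (inj₁ (p , u)) = copies (value p) (code p u)
  s (inj₂ t) = z t

  -- Each position p carries the ray (p , 0), (p , 1), … of copies of its value; φ shifts every ray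
  -- down, sends the first copy of a block-t value to zₜ, and moves the spine forward.
  φ : T → T
  φ (inj₁ (p , zero)) = inj₂ (proj₁ p)
  φ (inj₁ (p , suc u)) = inj₁ (p , u)
  φ (inj₂ t) = inj₂ (suc t)

  n-ray : ∀ p u → n (s (inj₁ (p , u))) ≡ value p
  n-ray p u = proj₂ (proj₁ (position-ok p)) _

  s-inj : Injective _≡_ _≡_ s
  s-inj {inj₂ t} {inj₂ t'} e = cong inj₂ (z-inj e)
  s-inj {inj₁ (p , u)} {inj₂ t} e = ⊥-elim (proj₂ (position-ok p) t (trans (sym (cong n e)) (n-ray p u)))
  s-inj {inj₂ t} {inj₁ (p , u)} e = ⊥-elim (proj₂ (position-ok p) t (trans (cong n e) (n-ray p u)))
  s-inj {inj₁ (p , u)} {inj₁ (p' , u')} e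
    with code-injective {p} {u} {p'} {u'}
           (proj₁ (proj₁ (position-ok p)) (trans e (cong (λ a → copies a (code p' u')) (sym same-value))))
    where
    same-value : value p ≡ value p'
    same-value = trans (sym (n-ray p u)) (trans (cong n e) (n-ray p' u'))
  ... | refl , refl = refl

  first-copies : ℕ → List T
  first-copies t = tabulate (λ j → inj₁ ((t , j) , 0))

  preimage : T → List T
  preimage (inj₁ (p , u)) = inj₁ (p , suc u) ∷ []
  preimage (inj₂ zero) = first-copies 0
  preimage (inj₂ (suc t)) = inj₂ t ∷ first-copies (suc t)

  preimage-complete : ∀ x → x ∈ preimage (φ x)
  preimage-complete (inj₁ ((zero , j) , zero)) = ∈-tabulate⁺ j
  preimage-complete (inj₁ ((suc t , j) , zero)) = there (∈-tabulate⁺ j)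
  preimage-complete (inj₁ (p , suc u)) = here refl
  preimage-complete (inj₂ t) = here refl

  preimage-sound : ∀ y {x} → x ∈ preimage y → φ x ≡ y
  preimage-sound (inj₁ _) (here refl) = refl
  preimage-sound (inj₂ zero) x∈ with ∈-tabulate⁻ x∈
  ... | _ , refl = refl
  preimage-sound (inj₂ (suc t)) (here refl) = refl
  preimage-sound (inj₂ (suc t)) (there x∈) with ∈-tabulate⁻ x∈
  ... | _ , refl = refl

  first-copy-injective : ∀ t {j j' : Fin (length (block t))} →
                         _≡_ {A = T} (inj₁ ((t , j) , 0)) (inj₁ ((t , j') , 0)) → j ≡ j'
  first-copy-injective t refl = refl

  preimage-unique : ∀ y → Unique (preimage y)
  preimage-unique (inj₁ _) = [] ∷ []
  preimage-unique (inj₂ zero) = Unique.tabulate⁺ (first-copy-injective 0)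
  preimage-unique (inj₂ (suc t)) = All.tabulate⁺ (λ _ ()) ∷ Unique.tabulate⁺ (first-copy-injective (suc t))

  sum-first-copies : ∀ t → sum (map (n ∘ s) (first-copies t)) ≡ sum (block t)
  sum-first-copies t = begin
    sum (map (n ∘ s) (first-copies t))
      ≡⟨ cong sum (map-tabulate (λ j → inj₁ ((t , j) , 0)) (n ∘ s)) ⟩
    sum (tabulate (λ j → n (s (inj₁ ((t , j) , 0)))))
      ≡⟨ cong sum (tabulate-cong (λ j → n-ray (t , j) 0)) ⟩
    sum (tabulate (lookup (block t)))
      ≡⟨ cong sum (tabulate-lookup (block t)) ⟩
    sum (block t)
      ∎
    where open ≡-Reasoning

  preimage-sum : ∀ y → sum (map (n ∘ s) (preimage y)) ≡ n (s y)
  preimage-sum (inj₁ (p , u)) = trans (+-identityʳ _) (trans (n-ray p (suc u)) (sym (n-ray p u)))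
  preimage-sum (inj₂ zero) = trans (sum-first-copies 0) (sym z-zero)
  preimage-sum (inj₂ (suc t)) = trans (cong (n (z t) +_) (sum-first-copies (suc t))) (sym (z-suc t))

  φ-fibre : ∀ y → FibreSum (n ∘ s) φ y
  φ-fibre y = preimage y , preimage-unique y ,
              (λ x φx≡y → subst (λ y → x ∈ preimage y) φx≡y (preimage-complete x)) ,
              (λ x → preimage-sound y) , preimage-sum y

  block₀-nonempty : 1 ≤ length (block 0)
  block₀-nonempty = nonempty (block 0) z-zero
    where
    nonempty : ∀ xs → n (z 0) ≡ sum xs → 1 ≤ length xs
    nonempty [] n-z₀≡0 = ⊥-elim (<⇒≢ (pos (z 0)) (sym n-z₀≡0))
    nonempty (_ ∷ _) _ = s≤s z≤n

  φ-surj : Surj φ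
  φ-surj (inj₁ (p , u)) = inj₁ (p , suc u) , refl
  φ-surj (inj₂ zero) = inj₁ ((0 , fromℕ< block₀-nonempty) , 0) , refl
  φ-surj (inj₂ (suc t)) = inj₂ t , refl

  φ-ninj : ¬ Injective _≡_ _≡_ φ
  φ-ninj = branching⇒ninj branching
    where
    branching⇒ninj : 2 ≤ length (block 0) ⊎ ∃ (λ t → 1 ≤ length (block (suc t))) → ¬ Injective _≡_ _≡_ φ
    branching⇒ninj (inj₁ two) φ-inj = 0≢1+n (begin
      0                                    ≡⟨ Fin.toℕ-fromℕ< block₀-nonempty ⟨
      toℕ (fromℕ< block₀-nonempty)         ≡⟨ cong toℕ (first-copy-injective 0 (φ-inj refl)) ⟩
      toℕ (fromℕ< two)                     ≡⟨ Fin.toℕ-fromℕ< two ⟩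
      1                                    ∎)
      where open ≡-Reasoning
    branching⇒ninj (inj₂ (t , nonempty)) φ-inj with φ-inj {inj₂ t} {inj₁ ((suc t , fromℕ< nonempty) , 0)} refl
    ... | ()

  merger : Merger (n ∘ s)
  merger = φ , φ-surj , φ-ninj , φ-fibre

KSet-positive : {I : Set} {n : I → ℕ} → (∀ i → 0 < n i) → ∀ {v} → KSet n v → 0 < v
KSet-positive pos (g , _ , n-g≡v) = subst (0 <_) (n-g≡v 0) (pos (g 0))

module MergerAnalysis (em : ExcludedMiddle 0ℓ) {I : Set} (n : I → ℕ) (pos : ∀ i → 0 < n i)
                      (f : I → I) (f-surj : Surj f) (f-fibre : ∀ j → FibreSum n f j) where

  open Classical em

  K : ℕ → Set
  K = KSet n

  preimage : I → List I
  preimage j = proj₁ (f-fibre j)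

  preimage-complete : ∀ {i} → i ∈ preimage (f i)
  preimage-complete {i} = proj₁ (proj₂ (proj₂ (f-fibre (f i)))) i refl

  preimage-sound : ∀ {i j} → i ∈ preimage j → f i ≡ j
  preimage-sound {i} {j} = proj₁ (proj₂ (proj₂ (proj₂ (f-fibre j)))) i

  preimage-sum : ∀ j → sum (map n (preimage j)) ≡ n j
  preimage-sum j = proj₂ (proj₂ (proj₂ (proj₂ (f-fibre j))))

  n-≤-f : ∀ x → n x ≤ n (f x)
  n-≤-f x = subst (n x ≤_) (preimage-sum (f x)) (∈⇒≤sum (∈-map⁺ n preimage-complete))

  fibre-split : ∀ x → Σ (List I) λ rest → n (f x) ≡ n x + sum (map n rest)
                × (∀ {y} → y ∈ rest → f y ≡ f x × n y < n (f x))
                × (∀ {y} → f y ≡ f x → y ≢ x → y ∈ rest)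
  fibre-split x with sum-remove n (preimage-complete {x})
  ... | rest , sum≡ , rest⊆ , others∈rest = rest , n-fx≡ , smaller , others
    where
    n-fx≡ : n (f x) ≡ n x + sum (map n rest)
    n-fx≡ = trans (sym (preimage-sum (f x))) sum≡
    smaller : ∀ {y} → y ∈ rest → f y ≡ f x × n y < n (f x)
    smaller {y} y∈rest = preimage-sound (rest⊆ y∈rest) , (begin-strict
      n y                    <⟨ m<n+m (n y) (pos x) ⟩
      n x + n y              ≤⟨ +-monoʳ-≤ (n x) (∈⇒≤sum (∈-map⁺ n y∈rest)) ⟩
      n x + sum (map n rest) ≡⟨ n-fx≡ ⟨
      n (f x)                ∎)
      where open ≤-Reasoning
    others : ∀ {y} → f y ≡ f x → y ≢ x → y ∈ rest
    others fy≡fx y≢x = others∈rest (subst (λ j → _ ∈ preimage j) fy≡fx preimage-complete) y≢x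

  OnCycle : I → Set
  OnCycle x = ∃ λ p → fold x f (suc p) ≡ x

  fold-f : ∀ m x → fold (f x) f m ≡ f (fold x f m)
  fold-f zero x = refl
  fold-f (suc m) x = cong f (fold-f m x)

  OnCycle-f : ∀ {x} → OnCycle x → OnCycle (f x)
  OnCycle-f {x} (p , e) = p , trans (fold-f (suc p) x) (cong f e)

  OnCycle-fold : ∀ q {x} → OnCycle x → OnCycle (fold x f q)
  OnCycle-fold zero c = c
  OnCycle-fold (suc q) c = OnCycle-f (OnCycle-fold q c)

  n-≤-fold : ∀ p x → n x ≤ n (fold x f p)
  n-≤-fold zero x = ≤-refl
  n-≤-fold (suc p) x = ≤-trans (n-≤-fold p x) (n-≤-f _)

  OnCycle⇒n-f≡n : ∀ {x} → OnCycle x → n (f x) ≡ n x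
  OnCycle⇒n-f≡n {x} (p , e) =
    ≤-antisym (subst (λ y → n (f x) ≤ n y) (trans (fold-f p x) e) (n-≤-fold p (f x))) (n-≤-f x)

  increase⇒¬OnCycle : ∀ {x} → n x < n (f x) → ¬ OnCycle x
  increase⇒¬OnCycle lt c = <⇒≢ lt (sym (OnCycle⇒n-f≡n c))

  -- The cycle predecessor u of w has n u = n w, so it exhausts the fibre of w.
  OnCycle-preimage : ∀ {w} → (c : OnCycle w) → ∀ {x} → f x ≡ w → x ≡ fold w f (proj₁ c)
  OnCycle-preimage {w} c@(p , fu≡w) {x} fx≡w with em {x ≡ fold w f p}
  ... | yes x≡u = x≡u
  ... | no x≢u with fibre-split (fold w f p)
  ...   | rest , n-fu≡ , _ , others = ⊥-elim (<-irrefl refl (begin-strict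
    n u                    <⟨ m<m+n (n u) (pos x) ⟩
    n u + n x              ≤⟨ +-monoʳ-≤ (n u) (∈⇒≤sum (∈-map⁺ n x∈rest)) ⟩
    n u + sum (map n rest) ≡⟨ n-fu≡ ⟨
    n (f u)                ≡⟨ OnCycle⇒n-f≡n (OnCycle-fold p c) ⟩
    n u                    ∎))
    where
    u = fold w f p
    x∈rest = others (trans fx≡w (sym fu≡w)) x≢u
    open ≤-Reasoning

  OnCycle-f⁻¹ : ∀ {x} → OnCycle (f x) → OnCycle x
  OnCycle-f⁻¹ c = subst OnCycle (sym (OnCycle-preimage c refl)) (OnCycle-fold (proj₁ c) c)

  back : I → ℕ → I
  back x zero = x
  back x (suc s) = proj₁ (f-surj (back x s))

  f-back : ∀ x s → f (back x (suc s)) ≡ back x s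
  f-back x s = proj₂ (f-surj (back x s))

  fold-back : ∀ x q s → fold (back x (q + s)) f q ≡ back x s
  fold-back x zero s = refl
  fold-back x (suc q) s =
    trans (sym (fold-f q _)) (trans (cong (λ y → fold y f q) (f-back x (q + s))) (fold-back x q s))

  n-back-≤ : ∀ x s → n (back x (suc s)) ≤ n (back x s)
  n-back-≤ x s = subst (λ y → n (back x (suc s)) ≤ n y) (f-back x s) (n-≤-f _)

  back-injective : ∀ {x} → ¬ OnCycle x → Injective _≡_ _≡_ (back x)
  back-injective {x} acyclic = no-return⇒injective (back x) λ q k e → acyclic (x-on-cycle q k e)
    where
    x-on-cycle : ∀ q k → back x (suc q + k) ≡ back x k → OnCycle x
    x-on-cycle q k e = subst OnCycle returns-to-x (OnCycle-fold k cycle)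
      where
      cycle : OnCycle (back x k)
      cycle = q , trans (cong (λ y → fold y f (suc q)) (sym e)) (fold-back x (suc q) k)
      returns-to-x : fold (back x k) f k ≡ x
      returns-to-x = trans (cong (λ s → fold (back x s) f k) (sym (+-identityʳ k))) (fold-back x k 0)

  Drop : I → ℕ → Set
  Drop x s = n (back x (suc s)) < n (back x s)

  no-drop⇒n-back≡ : ∀ {x t} → (∀ {s} → s < t → ¬ Drop x s) → ∀ {s} → s ≤ t → n (back x s) ≡ n x
  no-drop⇒n-back≡ _ {zero} _ = refl
  no-drop⇒n-back≡ {x} no-drop {suc s} s<t =
    trans (≤-antisym (n-back-≤ x s) (≮⇒≥ (no-drop s<t))) (no-drop⇒n-back≡ no-drop (<⇒≤ s<t))

  acyclic⇒Gen : ∀ x → ¬ OnCycle x → Gen K (n x)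
  acyclic⇒Gen x = <-rec Goal step (n x) x refl
    where
    Goal : ℕ → Set
    Goal m = ∀ x → n x ≡ m → ¬ OnCycle x → Gen K (n x)
    step : ∀ m → (∀ {m'} → m' < m → Goal m') → Goal m
    step _ IH x refl acyclic with em {∃ (Drop x)}
    ... | no ¬drop = gen (back x , back-injective acyclic ,
                          λ s → no-drop⇒n-back≡ {t = s} (λ {s'} _ drop → ¬drop (s' , drop)) ≤-refl)
    ... | yes (s₀ , drop-s₀) with least-witness {Drop x} {s₀} drop-s₀
    ...   | s , drop-s , first with fibre-split (back x (suc s))
    ...     | rest , n-fz≡ , smaller , _ =
      subst (Gen K) n-x≡ (Gen₀-positive (subst (0 <_) (sym n-x≡) (pos x)) (Gen₀-+ (inj₂ Gen-z) Gen-rest))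
      where
      z = back x (suc s)
      n-fz≡n-x : n (f z) ≡ n x
      n-fz≡n-x = trans (cong n (f-back x s)) (no-drop⇒n-back≡ first ≤-refl)
      n-x≡ : n z + sum (map n rest) ≡ n x
      n-x≡ = trans (sym n-fz≡) n-fz≡n-x
      IH-below-fz : ∀ w → n w < n (f z) → n w < n (f w) → Gen K (n w)
      IH-below-fz w w<fz w<fw = IH (subst (n w <_) n-fz≡n-x w<fz) w refl (increase⇒¬OnCycle w<fw)
      z<fz : n z < n (f z)
      z<fz = subst (λ j → n z < n j) (sym (f-back x s)) drop-s
      Gen-z : Gen K (n z)
      Gen-z = IH-below-fz z z<fz z<fz
      Gen-rest : Gen₀ {K} (sum (map n rest))
      Gen-rest = Gen₀-sum n rest λ w∈ → let fw≡fz , w<fz = smaller w∈ in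
                   IH-below-fz _ w<fz (subst (λ j → _ < n j) (sym fw≡fz) w<fz)

  n-f≡n+Gen₀ : ∀ x → ∃ λ r → n (f x) ≡ n x + r × Gen₀ {K} r
                       × (∀ {y} → f y ≡ f x → y ≢ x → n y ≤ r)
  n-f≡n+Gen₀ x with fibre-split x
  ... | rest , n-fx≡ , smaller , others =
    sum (map n rest) , n-fx≡ ,
    Gen₀-sum n rest (λ y∈ → let fy≡fx , y<fx = smaller y∈ in
                              acyclic⇒Gen _ (increase⇒¬OnCycle (subst (λ j → _ < n j) (sym fy≡fx) y<fx))) ,
    λ fy≡fx y≢x → ∈⇒≤sum (∈-map⁺ n (others fy≡fx y≢x))

  module Collision {i i' : I} (i≢i' : i ≢ i') (fi≡fi' : f i ≡ f i') where

    orbit : ℕ → I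
    orbit = fold (f i) f

    orbit-acyclic : ∀ t → ¬ OnCycle (orbit t)
    orbit-acyclic zero c = i≢i' (trans (OnCycle-preimage c refl) (sym (OnCycle-preimage c (sym fi≡fi'))))
    orbit-acyclic (suc t) c = orbit-acyclic t (OnCycle-f⁻¹ c)

    -- The weight of f i already splits as n i plus the positive rest containing n i'.
    orbit-Gen₂ : ∀ t → Gen₂ {K} (n (orbit t))
    orbit-Gen₂ zero with n-f≡n+Gen₀ i
    ... | r , n-fi≡ , Gen₀-r , others≤r = n i , r , Gen-i , Gen-r , n-fi≡
      where
      r-positive : 0 < r
      r-positive = <-≤-trans (pos i') (others≤r (sym fi≡fi') (λ i'≡i → i≢i' (sym i'≡i)))
      Gen-i : Gen K (n i)
      Gen-i = acyclic⇒Gen i (increase⇒¬OnCycle (subst (n i <_) (sym n-fi≡) (m<m+n (n i) r-positive)))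
      Gen-r : Gen K r
      Gen-r = Gen₀-positive r-positive Gen₀-r
    orbit-Gen₂ (suc t) with n-f≡n+Gen₀ (orbit t)
    ... | r , n-f≡ , Gen₀-r , _ = subst Gen₂ (sym n-f≡) (Gen₂-+ (orbit-Gen₂ t) Gen₀-r)

    orbit-no-return : ∀ q t → orbit (suc q + t) ≢ orbit t
    orbit-no-return q t e = orbit-acyclic t (q , trans (sym (fold-+ (f i) f (suc q) {t})) e)

    stable⇒K : ∀ t₀ → (∀ s → n (orbit (s + t₀)) ≡ n (orbit t₀)) → K (n (orbit t₀))
    stable⇒K t₀ stable = (λ s → orbit (s + t₀)) , no-return⇒injective _ no-return , stable
      where
      no-return : ∀ q s → orbit (suc q + s + t₀) ≢ orbit (s + t₀)
      no-return q s e = orbit-no-return q (s + t₀) (trans (cong orbit (sym (+-assoc (suc q) s t₀))) e)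

    impossible : Independent K → GcdFiniteness n → ⊥
    impossible indep finite = from-element (Gen-witness (proj₁ (proj₂ (proj₂ (orbit-Gen₂ 0)))))
      where
      from-element : ∃ K → ⊥
      from-element (k , Kk) =
        let t₀ , stable = monotone-bounded⇒stable (n ∘ orbit) (λ t → n-≤-f (orbit t)) (sum values) bounded
        in Independent⇒∉Gen₂ indep (KSet-positive pos) (orbit-Gen₂ t₀) (stable⇒K t₀ stable)
        where
        open GcdOf em (KSet-positive pos) Kk
        values : List ℕ
        values = proj₁ (finite (k , Kk) gcd gcd-IsGcdOf)
        bounded : ∀ t → n (orbit t) ≤ sum values
        bounded t = ∈⇒≤sum (proj₂ (finite (k , Kk) gcd gcd-IsGcdOf) _
                              ((orbit t , refl) , Gen₂-divisible gcd∣P (orbit-Gen₂ t)))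

module OfReversible (em : ExcludedMiddle 0ℓ) {I : Set} (i₀ : I) (n : I → ℕ) (pos : ∀ i → 0 < n i)
               (rev : Reversible n) where

  K : ℕ → Set
  K = KSet n

  choose : (a : ℕ) → Dec (K a) → ℕ → I
  choose a (yes (g , _)) = g
  choose a (no _) _ = i₀

  choose-ok : ∀ {a} (d : Dec (K a)) → K a → Copies n (choose a d) a
  choose-ok (yes (_ , g-inj , n-g≡)) _ = g-inj , n-g≡
  choose-ok (no ¬Ka) Ka = ⊥-elim (¬Ka Ka)

  -- One fixed enumeration per value, so that equal values in different blocks share their copies.
  copies : ℕ → ℕ → I
  copies a = choose a em

  no-chain : (z : ℕ → I) → Injective _≡_ _≡_ z → (block : ℕ → List ℕ) →
             (∀ t → All (λ a → K a × (∀ t' → n (z t') ≢ a)) (block t)) →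
             n (z 0) ≡ sum (block 0) → (∀ t → n (z (suc t)) ≡ n (z t) + sum (block (suc t))) →
             2 ≤ length (block 0) ⊎ ∃ (λ t → 1 ≤ length (block (suc t))) → ⊥
  no-chain z z-inj block block-ok z-zero z-suc branching =
    rev (Merger-extend em n s s-inj merger)
    where
    open Chain n pos z z-inj block copies
               (λ t → All.map (λ (Ka , off-spine) → choose-ok em Ka , off-spine) (block-ok t))
               z-zero z-suc branching

  Reversible⇒Independent : Independent K
  Reversible⇒Independent k (g , g-inj , n-g≡k) k∈⟨K∖k⟩
    with Gen⇒proper-sum (λ (_ , k≢k) → k≢k refl) k∈⟨K∖k⟩
  ... | xs , xs-ok , sum-xs≡k , two = no-chain g g-inj block block-ok z-zero z-suc (inj₁ two)
    where
    block : ℕ → List ℕ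
    block zero = xs
    block (suc _) = []
    block-ok : ∀ t → All (λ a → K a × (∀ t' → n (g t') ≢ a)) (block t)
    block-ok zero = All.map (λ (Ka , a≢k) → Ka , λ t' n-gt'≡a → a≢k (trans (sym n-gt'≡a) (n-g≡k t'))) xs-ok
    block-ok (suc _) = []
    z-zero : n (g 0) ≡ sum xs
    z-zero = trans (n-g≡k 0) (sym sum-xs≡k)
    z-suc : ∀ t → n (g (suc t)) ≡ n (g t) + 0
    z-suc t = trans (n-g≡k (suc t)) (trans (sym (n-g≡k t)) (sym (+-identityʳ _)))

  module InfiniteMultiples {k : ℕ} (Kk : K k) {d : ℕ} (d-gcd : IsGcdOf K d)
                           (infinite : ¬ FiniteSetℕ (λ v → Value n v × d ∣ v)) where

    open Classical em
    open GcdOf em (KSet-positive pos) Kk using (gcd∣P; multiple-of-gcd⇒Reaches)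

    instance
      k-nonZero : NonZero k
      k-nonZero = >-nonZero (KSet-positive pos Kk)

    class-infinite : ∃ λ c → ¬ FiniteSetℕ (λ v → (Value n v × d ∣ v) × v % k ≡ c)
    class-infinite = infinite-fibre infinite (_% k) k (λ {v} _ → m%n<n v k)

    c : ℕ
    c = proj₁ class-infinite

    InClass : ℕ → Set
    InClass v = (Value n v × d ∣ v) × v % k ≡ c

    -- As gcd K divides d, every multiple of d is congruent modulo k to an element of ⟨K⟩.
    ⟨K⟩-meets-class : ∃ λ w → Gen K w × w % k ≡ c
    ⟨K⟩-meets-class with infinite⇒unbounded (proj₂ class-infinite) 0
    ... | v , ((_ , d∣v) , v%k≡c) , 0<v
      with multiple-of-gcd⇒Reaches (∣-trans (proj₂ d-gcd _ (λ _ → gcd∣P)) d∣v)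
    ...   | a , Gen₀-w = v + a * k , Gen₀-positive (<-≤-trans 0<v (m≤m+n v (a * k))) Gen₀-w ,
                         trans ([m+kn]%n≡m%n v a k) v%k≡c

    w : ℕ
    w = proj₁ ⟨K⟩-meets-class

    w-decomposition : Σ (List ℕ) λ xs → All K xs × sum xs ≡ w × 1 ≤ length xs
    w-decomposition = Gen⇒sum (proj₁ (proj₂ ⟨K⟩-meets-class))

    xs : List ℕ
    xs = proj₁ w-decomposition

    sum-xs≡w : sum xs ≡ w
    sum-xs≡w = proj₁ (proj₂ (proj₂ w-decomposition))

    -- The spine runs through values of the class above w + k, which exceed every block entry.
    spine-values : Σ (ℕ → ℕ) λ v → (∀ t → InClass (v t) × w + k < v t) × (∀ t → v t < v (suc t))
    spine-values = increasing-sequence-above (proj₂ class-infinite) (w + k)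

    v : ℕ → ℕ
    v = proj₁ spine-values

    v-above : ∀ t → w + k < v t
    v-above t = proj₂ (proj₁ (proj₂ spine-values) t)

    v-increasing : ∀ t → v t < v (suc t)
    v-increasing = proj₂ (proj₂ spine-values)

    v-value : ∀ t → Value n (v t)
    v-value t = proj₁ (proj₁ (proj₁ (proj₁ (proj₂ spine-values) t)))

    z : ℕ → I
    z t = proj₁ (v-value t)

    n-z : ∀ t → n (z t) ≡ v t
    n-z t = proj₂ (v-value t)

    z-inj : Injective _≡_ _≡_ z
    z-inj {t} {t'} e = increasing⇒injective v v-increasing (trans (sym (n-z t)) (trans (cong n e) (n-z t')))

    v%k≡c : ∀ t → v t % k ≡ c
    v%k≡c t = proj₂ (proj₁ (proj₁ (proj₂ spine-values) t))

    v₀-step : ∃ λ q → v 0 ≡ w + q * k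
    v₀-step = ≡-mod⇒+* (trans (v%k≡c 0) (sym (proj₂ (proj₂ ⟨K⟩-meets-class))))
                       (≤-trans (m≤m+n w k) (<⇒≤ (v-above 0)))

    v-step : ∀ t → ∃ λ q → v (suc t) ≡ v t + q * k
    v-step t = ≡-mod⇒+* (trans (v%k≡c (suc t)) (sym (v%k≡c t))) (<⇒≤ (v-increasing t))

    q₀ : ℕ
    q₀ = proj₁ v₀-step

    q : ℕ → ℕ
    q t = proj₁ (v-step t)

    v-step-positive : ∀ t → 1 ≤ q t
    v-step-positive t = positive (v-increasing t) (proj₂ (v-step t))
      where
      positive : ∀ {a b q} → a < b → b ≡ a + q * k → 1 ≤ q
      positive {a} {q = zero} a<b b≡a+0 = ⊥-elim (<⇒≢ a<b (sym (trans b≡a+0 (+-identityʳ a))))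
      positive {q = suc _} _ _ = s≤s z≤n

    block : ℕ → List ℕ
    block zero = xs ++ replicate q₀ k
    block (suc t) = replicate (q t) k

    off-spine : ∀ {a} → a ≤ w + k → ∀ t → n (z t) ≢ a
    off-spine a≤w+k t n-zt≡a = <⇒≢ (≤-<-trans a≤w+k (v-above t)) (trans (sym n-zt≡a) (n-z t))

    k-ok : K k × (∀ t → n (z t) ≢ k)
    k-ok = Kk , off-spine (m≤n+m k w)

    block-ok : ∀ t → All (λ a → K a × (∀ t' → n (z t') ≢ a)) (block t)
    block-ok zero = All.++⁺ (All.zipWith (λ (Ka , a≤w) → Ka , off-spine (≤-trans a≤w (m≤m+n w k)))
                                         (proj₁ (proj₂ w-decomposition) , All.tabulate xs-below-w))
                            (All.replicate⁺ _ k-ok)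
      where
      xs-below-w : ∀ {a} → a ∈ xs → a ≤ w
      xs-below-w a∈xs = subst (_ ≤_) sum-xs≡w (∈⇒≤sum a∈xs)
    block-ok (suc t) = All.replicate⁺ _ k-ok

    z-zero : n (z 0) ≡ sum (block 0)
    z-zero = begin
      n (z 0)                                   ≡⟨ n-z 0 ⟩
      v 0                                       ≡⟨ proj₂ v₀-step ⟩
      w + q₀ * k                                ≡⟨ cong₂ _+_ sum-xs≡w (sum-replicate q₀ k) ⟨
      sum xs + sum (replicate q₀ k)             ≡⟨ sum-++ xs _ ⟨
      sum (block 0)                             ∎
      where open ≡-Reasoning

    z-suc : ∀ t → n (z (suc t)) ≡ n (z t) + sum (block (suc t))
    z-suc t = trans (n-z (suc t))
                    (trans (proj₂ (v-step t)) (cong₂ _+_ (sym (n-z t)) (sym (sum-replicate (q t) k))))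

    impossible : ⊥
    impossible = no-chain z z-inj block block-ok z-zero z-suc
                          (inj₂ (0 , subst (1 ≤_) (sym (length-replicate (q 0))) (v-step-positive 0)))

  Reversible⇒GcdFiniteness : GcdFiniteness n
  Reversible⇒GcdFiniteness (k , Kk) d d-gcd with em {FiniteSetℕ (λ v → Value n v × d ∣ v)}
  ... | yes finite = finite
  ... | no infinite = ⊥-elim (InfiniteMultiples.impossible Kk d-gcd infinite)

Independent⇒GcdFiniteness⇒Reversible : ExcludedMiddle 0ℓ → {I : Set} (n : I → ℕ) → (∀ i → 0 < n i) →
                                       Independent (KSet n) → GcdFiniteness n → Reversible n
Independent⇒GcdFiniteness⇒Reversible em n pos indep finite (f , f-surj , f-ninj , f-fibre) =
  let i , i' , fi≡fi' , i≢i' = Classical.collision em f-ninj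
  in MergerAnalysis.Collision.impossible em n pos f f-surj f-fibre i≢i' fi≡fi' indep finite

proposition4p4 : ExcludedMiddle 0ℓ → (I : Set) → I → (n : I → ℕ) → (∀ i → 0 < n i) →
    Reversible n ⇔
      (Independent (KSet n) ×
        ((∃ λ m → KSet n m) → ∀ d → IsGcdOf (KSet n) d →
          FiniteSetℕ (λ v → (∃ λ i → n i ≡ v) × d ∣ v)))
proposition4p4 em I i₀ n pos = mk⇔
  (λ rev → Reversible⇒Independent rev , Reversible⇒GcdFiniteness rev)
  (λ (indep , finite) → Independent⇒GcdFiniteness⇒Reversible em n pos indep finite)
  where open OfReversible em i₀ n pos
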